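{- Let $T$ be a finite rooted ordered tree with root $r$, let $v\in T\setminus\{r\}$, let $w:=\mathsf{pa}^*(v)$, and let $v_2\in T[v]\setminus\{v\}$ satisfy $\mathsf{pa}^*(v_2)=w$. Then $v_2<^*v$.
   Context: $T[v]$ is the set of $v$ and its descendants in $T$. $\mathsf{pa}^*$ is the parent function of the dual tree $T^*$ and $<^*$ is the depth-first traversal order (preorder) of $T^*$. The dual $T^*$ has the same vertex set and root $r$; with $rmc_T(u)$ the rightmost child and $ils_T(u)$ the immediate left sibling of $u$ in $T$: (1a) $r$ has no parent in $T^*$; (1b) if $v=rmc_T(r)$ then $v$ is the rightmost child of $r$ in $T^*$; (2) if $v=rmc_T(u)$ with $u\ne r$, then $v$ is the immediate left sibling of $u$ in $T^*$, so $\mathsf{pa}^*(v)=\mathsf{pa}^*(u)$; (3) if $v=ils_T(u)$, then $v$ is the rightmost child of $u$ in $T^*$, so $\mathsf{pa}^*(v)=u$. -}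

module Defs where

open import Data.Nat using (ℕ; zero; suc; _∸_)
open import Data.List using (List; []; _∷_; _++_; length)
open import Data.Product using (Σ; ∃; ∃-syntax; _×_; _,_)
open import Data.Sum using (_⊎_)
open import Relation.Binary.PropositionalEquality using (_≡_; _≢_)

-- Finite rooted ordered trees: rose trees (children listed left to right).
data Tree : Set where
  node : List Tree → Tree

-- A vertex is named by its path from the root, written in REVERSE order:
-- [] is the root r, and (i ∷ p) is the i-th child (0-based, from the left)
-- of the vertex p.  So the T-parent of (i ∷ p) is p.
Path : Set
Path = List ℕ

data _!_≡_ {A : Set} : List A → ℕ → A → Set where
  here  : ∀ {x xs} → (x ∷ xs) ! zero ≡ x
  there : ∀ {x y xs i} → xs ! i ≡ y → (x ∷ xs) ! suc i ≡ y

data Sub (T : Tree) : Path → Tree → Set where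
  root  : Sub T [] T
  child : ∀ {p ts i s} → Sub T p (node ts) → ts ! i ≡ s → Sub T (i ∷ p) s

Vertex : Tree → Path → Set
Vertex T p = ∃[ s ] Sub T p s

data RMC (T : Tree) : Path → Path → Set where
  rmc : ∀ {u t ts} → Sub T u (node (t ∷ ts)) →
        RMC T u (length ts ∷ u)

data ILS (T : Tree) : Path → Path → Set where
  ils : ∀ {i p} → Vertex T (suc i ∷ p) → ILS T (suc i ∷ p) (i ∷ p)

InSubtree : Tree → Path → Path → Set
InSubtree T v₂ v = Vertex T v₂ × ∃[ q ] v₂ ≡ q ++ v

-- The parent function pa* of the dual tree T*, as a relation:
-- PaStar T v w  means  pa*(v) = w.  Constructors are rules (1b), (2), (3).
data PaStar (T : Tree) : Path → Path → Set where
  r1b : ∀ {v} → RMC T [] v → PaStar T v []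
  r2  : ∀ {u v w} → RMC T u v → u ≢ [] → PaStar T u w → PaStar T v w
  r3  : ∀ {u v} → ILS T u v → PaStar T v u

-- Immediate left sibling in T*: by rule (2), rmc_T(u) is the immediate
-- left sibling of u in T* (for u ≠ r).
ILSStar : Tree → Path → Path → Set
ILSStar T a b = RMC T b a × b ≢ []

data LeftStar (T : Tree) : Path → Path → Set where
  imm  : ∀ {a b} → ILSStar T a b → LeftStar T a b
  step : ∀ {a c b} → ILSStar T a c → LeftStar T c b → LeftStar T a b

data AncStar (T : Tree) (a : Path) : Path → Set where
  self : AncStar T a a
  up   : ∀ {x y} → PaStar T x y → AncStar T a y → AncStar T a x

ProperAncStar : Tree → Path → Path → Set
ProperAncStar T a x = ∃[ y ] (PaStar T x y × AncStar T a y)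

-- Preorder (depth-first order) <* of T*:  x <* y  iff  x is a proper
-- T*-ancestor of y, or x and y lie in the T*-subtrees of two T*-siblings
-- a, b with a to the left of b.
_<*[_]_ : Path → Tree → Path → Set
x <*[ T ] y = ProperAncStar T x y
            ⊎ ∃[ a ] ∃[ b ] (LeftStar T a b × AncStar T a x × AncStar T b y)

{-# OPTIONS --safe #-}
-- Walking down from v to a proper T-descendant x with the same pa* can only use
-- rule (2): rule (1b) would force v to be the root, and rule (3) would make
-- pa*(x) a proper descendant of v, which is too deep to be pa*(v).  Each rule (2)
-- step goes to a rightmost child, which is the immediate left T*-sibling, so x
-- ends up to the left of v among the T*-children of pa*(v).

module Submission where

open import Defs
open import Data.List using ([]; _∷_; _++_; length)
open import Data.List.Properties using (length-++-≤ʳ)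
open import Data.Nat using (_≤_; z≤n; s≤s)
open import Data.Nat.Properties using (≤-refl; m≤n⇒m≤1+n; <⇒≱)
open import Data.Product using (_,_)
open import Data.Sum using (inj₂)
open import Data.Empty using (⊥-elim)
open import Relation.Nullary using (¬_)
open import Relation.Binary.PropositionalEquality using (_≢_; refl)

paStar-length-≤ : ∀ {T v w} → PaStar T v w → length w ≤ length v
paStar-length-≤ (r1b _)            = z≤n
paStar-length-≤ (r2 (rmc _) _ pu)  = m≤n⇒m≤1+n (paStar-length-≤ pu)
paStar-length-≤ (r3 (ils _))       = ≤-refl

¬paStar-to-proper-descendant : ∀ {T v} k q → ¬ PaStar T v (k ∷ q ++ v)
¬paStar-to-proper-descendant {v = v} k q pv =
  <⇒≱ (s≤s (length-++-≤ʳ v {q})) (paStar-length-≤ pv)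

proper-descendant-leftStar : ∀ {T v w} j q → v ≢ [] →
                             PaStar T v w → PaStar T (j ∷ q ++ v) w →
                             LeftStar T (j ∷ q ++ v) v
proper-descendant-leftStar j []      v≢[] pv (r1b (rmc _))    = ⊥-elim (v≢[] refl)
proper-descendant-leftStar j (k ∷ q) v≢[] pv (r1b ())
proper-descendant-leftStar j []      v≢[] pv (r2 (rmc s) _ _) = imm (rmc s , v≢[])
proper-descendant-leftStar j (k ∷ q) v≢[] pv (r2 (rmc s) u≢[] pu) =
  step (rmc s , u≢[]) (proper-descendant-leftStar k q v≢[] pv pu)
proper-descendant-leftStar j q       v≢[] pv (r3 (ils _)) =
  ⊥-elim (¬paStar-to-proper-descendant _ q pv)

leftStar⇒<* : ∀ {T x y} → LeftStar T x y → x <*[ T ] y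
leftStar⇒<* {x = x} {y} x<y = inj₂ (x , y , x<y , self , self)

lemma3 : (T : Tree) (v w v₂ : Path) →
           Vertex T v → v ≢ [] →
           PaStar T v w →
           InSubtree T v₂ v → v₂ ≢ v →
           PaStar T v₂ w →
           v₂ <*[ T ] v
lemma3 T v w v₂ _ v≢[] pv (_ , []    , refl) v₂≢v _   = ⊥-elim (v₂≢v refl)
lemma3 T v w v₂ _ v≢[] pv (_ , j ∷ q , refl) _    pv₂ =
  leftStar⇒<* (proper-descendant-leftStar j q v≢[] pv pv₂)
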